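{- Let $G$ be a Dehn-Sommerville $q$-variety with vertex set $V(G)$, let $k\ge 1$, $A_k=\{0,1,\dots,k\}$, and let $g:V(G)\to A_k$ be an arbitrary function. Extend $g$ to $G$ by $g(x)=\{g(v): v\in x\}$ and put $G_g=\{x\in G: g(x)=A_k\}$. If $G_g$ is non-empty, then $G_g$ is a Dehn-Sommerville $(q-k)$-variety.
   Context: A finite abstract simplicial complex $G$ is a finite set of non-empty finite sets closed under taking non-empty subsets; its vertices are its one-element sets. The star of $x\in G$ is $U(x)=\{y\in G: x\subset y\}$, $\overline{U(x)}=\{z\in G: z\subset y\text{ for some }y\in U(x)\}$, and the unit sphere is $S(x)=\overline{U(x)}\setminus U(x)$. The empty complex is the Dehn-Sommerville $(-1)$-variety; inductively, for $q\ge0$, a non-empty complex is a Dehn-Sommerville $q$-variety if every unit sphere $S(x)$ is a Dehn-Sommerville $(q-1)$-variety. Graph version: for a finite simple graph, the unit sphere of a vertex is the subgraph induced by its neighbours; the empty graph is the Dehn-Sommerville $(-1)$-variety graph and, for $q\ge 0$, a non-empty graph is a Dehn-Sommerville $q$-variety graph if every unit sphere is a Dehn-Sommerville $(q-1)$-variety graph. A subset $U\subset G$ is called a Dehn-Sommerville $m$-variety if the graph with vertex set $U$ and edges $\{x,y\}$ for distinct $x,y\in U$ with $x\subset y$ or $y\subset x$ is a Dehn-Sommerville $m$-variety graph. -}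

module Defs where

open import Data.Nat using (ℕ; zero; suc)
open import Data.Integer using (ℤ; +_; -[1+_])
open import Data.Fin using (Fin)
open import Data.Fin.Subset using (Subset; _⊆_; _∈_; Nonempty)
open import Data.Product using (Σ; ∃; _×_)
open import Data.Sum using (_⊎_)
open import Data.Empty using (⊥)
open import Relation.Nullary using (¬_)
open import Relation.Binary.PropositionalEquality using (_≡_; _≢_)

-- A finite abstract simplicial complex on the vertex universe Fin n is given
-- by its membership predicate on subsets of Fin n (hence automatically finite).
Complex : ℕ → Set₁
Complex n = Subset n → Set

IsComplex : ∀ {n} → Complex n → Set
IsComplex {n} G =
  (∀ x → G x → Nonempty x) ×
  (∀ x y → G y → Nonempty x → x ⊆ y → G x)

-- S(x) = closure(U(x)) \ U(x), U(x) = {y ∈ G : x ⊆ y}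
UnitSphere : ∀ {n} → Complex n → Subset n → Complex n
UnitSphere G x z =
  (G z × (Σ (Subset _) λ y → G y × x ⊆ y × z ⊆ y)) × ¬ (x ⊆ z)

-- Dehn-Sommerville varieties of complexes, with shifted index:
-- DSCₙ m G  means "G is a Dehn-Sommerville (m-1)-variety".
DSCₙ : ∀ {n} → ℕ → Complex n → Set
DSCₙ zero G = ∀ x → ¬ G x
DSCₙ (suc m) G = (∃ λ x → G x) × (∀ x → G x → DSCₙ m (UnitSphere G x))

-- Dehn-Sommerville q-variety (q ≥ -1; for q < -1 the notion is not defined,
-- so nothing is such a variety)
DSComplex : ∀ {n} → ℤ → Complex n → Set
DSComplex (+ q) G = DSCₙ (suc q) G
DSComplex -[1+ zero ] G = DSCₙ zero G
DSComplex -[1+ suc _ ] G = ⊥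

Adj : ∀ {n} → Subset n → Subset n → Set
Adj x y = x ≢ y × (x ⊆ y ⊎ y ⊆ x)

-- Dehn-Sommerville varieties for (induced sub)graphs of this graph, given by
-- their vertex set W; unit sphere of v in W is the induced subgraph on the
-- neighbours of v in W.  DSGₙ m W means "W is a DS (m-1)-variety graph".
DSGₙ : ∀ {n} → ℕ → (Subset n → Set) → Set
DSGₙ zero W = ∀ v → ¬ W v
DSGₙ (suc m) W = (∃ λ v → W v) × (∀ v → W v → DSGₙ m (λ w → W w × Adj v w))

DSSubset : ∀ {n} → ℤ → (Subset n → Set) → Set
DSSubset (+ q) U = DSGₙ (suc q) U
DSSubset -[1+ zero ] U = DSGₙ zero U
DSSubset -[1+ suc _ ] U = ⊥

Surjects : ∀ {n k} → (Fin n → Fin (suc k)) → Subset n → Set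
Surjects {n} {k} g x = ∀ (a : Fin (suc k)) → ∃ λ v → v ∈ x × g v ≡ a

Gg : ∀ {n k} → Complex n → (Fin n → Fin (suc k)) → Subset n → Set
Gg G g x = G x × Surjects g x

-- A Dehn-Sommerville (m-1)-variety is pure: every face has at most m vertices and
-- lies in a face with at least m (induct through the links of vertices).  Every
-- face of G_g has at least k+1 vertices since g maps it onto A_k, and at most q+1.
-- A clique of the comparability graph on G_g is a chain of faces with pairwise
-- distinct sizes in [k+1, q+1]; if it has fewer than q-k+1 members, some size s is
-- missed, and between the largest member of size < s (or a transversal of g) and
-- the smallest member of size > s (or a facet) there is a face of G_g of size s
-- comparable with the whole chain.  So every clique extends until it has exactly
-- q-k+1 members, which unfolds to G_g being a Dehn-Sommerville (q-k)-variety.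

module Submission where

open import Defs
open import Data.Nat using (ℕ; zero; suc; _≤_; _<_; _+_; _∸_; z≤n; s≤s; _≤?_; _<?_)
open import Data.Nat.Properties
  using (≤-reflexive; ≤-trans; ≤-antisym; ≤-pred; <⇒≤; <⇒≢; >⇒≢; <⇒≱; ≰⇒>; <-trans; <-≤-trans;
         <-cmp; +-identityʳ; +-suc; +-monoˡ-≤; +-monoʳ-≤; +-monoʳ-<; +-cancelˡ-≡; m≤m+n; m≤n+m;
         m+n∸m≡n; m+[n∸m]≡n; m∸n+n≡m; ∸-monoˡ-<; module ≤-Reasoning)
  renaming (_≟_ to _≟ℕ_)
open import Data.Integer using (ℤ; +_; -[1+_]; _-_)
open import Data.Integer.Properties using (m-n≡m⊖n; ⊖-≥)
open import Data.Fin using (Fin; zero; suc; toℕ; fromℕ<; _≟_) renaming (_<_ to _<ᶠ_)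
open import Data.Fin.Properties using (pigeonhole; injective⇒≤; toℕ-injective; toℕ<n; toℕ-fromℕ<)
  renaming (any? to anyFin?)
open import Data.Fin.Subset
  using (Subset; inside; outside; ⁅_⁆; _∪_; _∈_; _∉_; _⊆_; _⊂_; ∣_∣; Nonempty; Empty; ⊥; ⊤)
  renaming (_-_ to _∖_)
open import Data.Fin.Subset.Properties
  using (drop-∷-⊆; out⊆; s⊆s; s⊂s; out⊂in; ⊆-refl; ⊆-trans; p⊆q⇒∣p∣≤∣q∣; p⊂q⇒∣p∣<∣q∣;
         ∣p∣≤∣x∷p∣; ∣⊥∣≡0; ∣⊤∣≡n; ∣⁅x⁆∣≡1; ∈⊤; ∉⊥; x∈⁅x⁆; x∈⁅y⁆⇒x≡y; x∈p∪q⁺; x∈p∪q⁻;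
         Empty-unique; nonempty?; p─⊥≡p; p─q⊆p; x∈p∧x≢y⇒x∈p-y; x∈p⇒∣p-x∣<∣p∣)
open import Data.Vec using ([]; _∷_; here; there)
open import Data.List using (List; []; _∷_; length; lookup)
open import Data.List.Membership.Propositional using () renaming (_∈_ to _∈ₗ_)
open import Data.List.Membership.Propositional.Properties using (∈-lookup)
open import Data.List.Relation.Unary.All as All using (All; []; _∷_)
open import Data.List.Relation.Unary.All.Properties using (¬Any⇒All¬)
open import Data.List.Relation.Unary.Any as Any using (Any; here; there; any?)
open import Data.List.Relation.Unary.Any.Properties using (lookup-index)
open import Data.List.Relation.Unary.AllPairs as AllPairs using (AllPairs; []; _∷_)
open import Data.Product using (∃; _×_; _,_; proj₁; proj₂)
open import Data.Sum using (_⊎_; inj₁; inj₂; swap)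
open import Function using (_∘_; const; flip)
open import Function.Definitions using (Injective)
open import Relation.Binary.Definitions using (Reflexive; Transitive; Symmetric; tri<; tri≈; tri>)
open import Relation.Nullary using (¬_; ¬?; Dec; yes; no; contradiction)
open import Relation.Nullary.Decidable using (decidable-stable)
open import Relation.Binary.PropositionalEquality
  using (_≡_; _≢_; refl; sym; trans; cong; subst; module ≡-Reasoning)

private
  variable
    n : ℕ
    p q : Subset n

⊆∧≢⇒⊂ : p ⊆ q → p ≢ q → p ⊂ q
⊆∧≢⇒⊂ {p = []}          {[]}          _   p≢q = contradiction refl p≢q
⊆∧≢⇒⊂ {p = outside ∷ p} {outside ∷ q} p⊆q p≢q = s⊂s (⊆∧≢⇒⊂ (drop-∷-⊆ p⊆q) (p≢q ∘ cong (outside ∷_)))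
⊆∧≢⇒⊂ {p = outside ∷ p} {inside  ∷ q} p⊆q _   = out⊂in (drop-∷-⊆ p⊆q)
⊆∧≢⇒⊂ {p = inside  ∷ p} {outside ∷ q} p⊆q _   = contradiction (p⊆q here) λ ()
⊆∧≢⇒⊂ {p = inside  ∷ p} {inside  ∷ q} p⊆q p≢q = s⊂s (⊆∧≢⇒⊂ (drop-∷-⊆ p⊆q) (p≢q ∘ cong (inside ∷_)))

∣p∪q∣≤∣p∣+∣q∣ : ∀ (p q : Subset n) → ∣ p ∪ q ∣ ≤ ∣ p ∣ + ∣ q ∣
∣p∪q∣≤∣p∣+∣q∣ []            []            = z≤n
∣p∪q∣≤∣p∣+∣q∣ (outside ∷ p) (outside ∷ q) = ∣p∪q∣≤∣p∣+∣q∣ p q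
∣p∪q∣≤∣p∣+∣q∣ (outside ∷ p) (inside  ∷ q) =
  subst (suc ∣ p ∪ q ∣ ≤_) (sym (+-suc ∣ p ∣ ∣ q ∣)) (s≤s (∣p∪q∣≤∣p∣+∣q∣ p q))
∣p∪q∣≤∣p∣+∣q∣ (inside  ∷ p) (s ∷ q) =
  s≤s (≤-trans (∣p∪q∣≤∣p∣+∣q∣ p q) (+-monoʳ-≤ ∣ p ∣ (∣p∣≤∣x∷p∣ s q)))

∣p∣≡1+∣p-x∣ : ∀ {x : Fin n} → x ∈ p → ∣ p ∣ ≡ suc ∣ p ∖ x ∣
∣p∣≡1+∣p-x∣ {p = inside  ∷ p} {zero}  here      = cong suc (cong ∣_∣ (sym (p─⊥≡p p)))
∣p∣≡1+∣p-x∣ {p = outside ∷ p} {suc x} (there x∈p) = ∣p∣≡1+∣p-x∣ x∈p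
∣p∣≡1+∣p-x∣ {p = inside  ∷ p} {suc x} (there x∈p) = cong suc (∣p∣≡1+∣p-x∣ x∈p)

Empty⇒∣p∣≡0 : Empty p → ∣ p ∣ ≡ 0
Empty⇒∣p∣≡0 {n} p-empty rewrite Empty-unique p-empty = ∣⊥∣≡0 n

∈-∖-split : ∀ {x y : Fin n} → x ∈ p → x ≡ y ⊎ x ∈ p ∖ y
∈-∖-split {x = x} {y} x∈p with x ≟ y
... | yes x≡y = inj₁ x≡y
... | no  x≢y = inj₂ (x∈p∧x≢y⇒x∈p-y x∈p x≢y)

⁅x⁆⊆p : ∀ {x : Fin n} → x ∈ p → ⁅ x ⁆ ⊆ p
⁅x⁆⊆p {x = x} x∈p y∈⁅x⁆ rewrite x∈⁅y⁆⇒x≡y x y∈⁅x⁆ = x∈p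

x∉p-x : ∀ {x : Fin n} → x ∉ p ∖ x
x∉p-x {p = _ ∷ p} {zero}  ()
x∉p-x {p = _ ∷ p} {suc x} (there x∈p-x) = x∉p-x {p = p} x∈p-x

subset-between : ∀ {s} → p ⊆ q → ∣ p ∣ ≤ s → s ≤ ∣ q ∣ → ∃ λ w → p ⊆ w × w ⊆ q × ∣ w ∣ ≡ s
subset-between {p = []} {[]} _ _ z≤n = [] , ⊆-refl , ⊆-refl , refl
subset-between {p = outside ∷ p} {outside ∷ q} p⊆q p≤s s≤q
  with w , p⊆w , w⊆q , ∣w∣≡s ← subset-between (drop-∷-⊆ p⊆q) p≤s s≤q
  = outside ∷ w , out⊆ p⊆w , out⊆ w⊆q , ∣w∣≡s
subset-between {p = inside ∷ p} {outside ∷ q} p⊆q _ _ = contradiction (p⊆q here) λ ()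
subset-between {p = inside ∷ p} {inside ∷ q} p⊆q (s≤s p≤s) (s≤s s≤q)
  with w , p⊆w , w⊆q , refl ← subset-between (drop-∷-⊆ p⊆q) p≤s s≤q
  = inside ∷ w , s⊆s p⊆w , s⊆s w⊆q , refl
subset-between {p = outside ∷ p} {inside ∷ q} {s} p⊆q p≤s s≤1+q with s ≤? ∣ q ∣
... | yes s≤q with w , p⊆w , w⊆q , ∣w∣≡s ← subset-between (drop-∷-⊆ p⊆q) p≤s s≤q
  = outside ∷ w , out⊆ p⊆w , out⊆ w⊆q , ∣w∣≡s
... | no s≰q = inside ∷ q , out⊆ (drop-∷-⊆ p⊆q) , ⊆-refl , ≤-antisym (≰⇒> s≰q) s≤1+q

image : ∀ {m} → (Fin n → Fin m) → Subset n → Subset m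
image f []            = ⊥
image f (outside ∷ p) = image (f ∘ suc) p
image f (inside  ∷ p) = ⁅ f zero ⁆ ∪ image (f ∘ suc) p

module _ {m : ℕ} where

  ∈-image : ∀ (f : Fin n → Fin m) {x} → x ∈ p → f x ∈ image f p
  ∈-image f {zero}  here            = x∈p∪q⁺ (inj₁ (x∈⁅x⁆ (f zero)))
  ∈-image {p = outside ∷ p} f {suc x} (there x∈p) = ∈-image (f ∘ suc) x∈p
  ∈-image {p = inside  ∷ p} f {suc x} (there x∈p) = x∈p∪q⁺ (inj₂ (∈-image (f ∘ suc) x∈p))

  image-⊆ : ∀ (f : Fin n → Fin m) {r : Subset m} → (∀ {x} → x ∈ p → f x ∈ r) → image f p ⊆ r
  image-⊆ {p = []}          f f[p]⊆r y∈∅ = contradiction y∈∅ ∉⊥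
  image-⊆ {p = outside ∷ p} f f[p]⊆r = image-⊆ (f ∘ suc) (f[p]⊆r ∘ there)
  image-⊆ {p = inside  ∷ p} f f[p]⊆r y∈ with x∈p∪q⁻ ⁅ f zero ⁆ _ y∈
  ... | inj₁ y∈⁅f0⁆ rewrite x∈⁅y⁆⇒x≡y (f zero) y∈⁅f0⁆ = f[p]⊆r here
  ... | inj₂ y∈rest = image-⊆ (f ∘ suc) (f[p]⊆r ∘ there) y∈rest

  ∣image∣≤ : ∀ (f : Fin n → Fin m) p → ∣ image f p ∣ ≤ ∣ p ∣
  ∣image∣≤ f []            = ≤-reflexive (∣⊥∣≡0 m)
  ∣image∣≤ f (outside ∷ p) = ∣image∣≤ (f ∘ suc) p
  ∣image∣≤ f (inside  ∷ p) = begin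
    ∣ ⁅ f zero ⁆ ∪ image (f ∘ suc) p ∣          ≤⟨ ∣p∪q∣≤∣p∣+∣q∣ ⁅ f zero ⁆ (image (f ∘ suc) p) ⟩
    (∣ ⁅ f zero ⁆ ∣) + (∣ image (f ∘ suc) p ∣)  ≡⟨ cong (_+ ∣ image (f ∘ suc) p ∣) (∣⁅x⁆∣≡1 (f zero)) ⟩
    suc ∣ image (f ∘ suc) p ∣                   ≤⟨ s≤s (∣image∣≤ (f ∘ suc) p) ⟩
    suc ∣ p ∣                                   ∎
    where open ≤-Reasoning

module _ {k : ℕ} (g : Fin n → Fin (suc k)) where

  Surjects⇒k<∣p∣ : Surjects g p → k < ∣ p ∣
  Surjects⇒k<∣p∣ {p} g[p]≡A = begin
    suc k          ≡⟨ sym (∣⊤∣≡n (suc k)) ⟩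
    ∣ ⊤ {suc k} ∣  ≤⟨ p⊆q⇒∣p∣≤∣q∣ ⊤⊆g[p] ⟩
    ∣ image g p ∣  ≤⟨ ∣image∣≤ g p ⟩
    ∣ p ∣          ∎
    where
    open ≤-Reasoning
    ⊤⊆g[p] : ⊤ ⊆ image g p
    ⊤⊆g[p] {a} _ with v , v∈p , refl ← g[p]≡A a = ∈-image g v∈p

  transversal : Surjects g p → ∃ λ t → t ⊆ p × Surjects g t × ∣ t ∣ ≤ suc k
  transversal g[p]≡A =
    image section ⊤ ,
    image-⊆ {p = ⊤} section (λ {a} _ → proj₁ (proj₂ (g[p]≡A a))) ,
    (λ a → section a , ∈-image section ∈⊤ , proj₂ (proj₂ (g[p]≡A a))) ,
    subst (∣ image section ⊤ ∣ ≤_) (∣⊤∣≡n (suc k)) (∣image∣≤ section ⊤)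
    where
    section : Fin (suc k) → Fin n
    section a = proj₁ (g[p]≡A a)

Link : Complex n → Fin n → Complex n
Link H v = UnitSphere H ⁅ v ⁆

-- Adjoining the empty face lets the link recursion treat z = ⁅ v ⁆ like any other face.
Augmented : Complex n → Complex n
Augmented H z = Empty z ⊎ H z

module _ {H : Complex n} (H-complex : IsComplex H) where

  private
    faces-nonempty : ∀ x → H x → Nonempty x
    faces-nonempty = proj₁ H-complex
    faces-closed : ∀ x y → H y → Nonempty x → x ⊆ y → H x
    faces-closed = proj₂ H-complex

  UnitSphere-isComplex : ∀ x → IsComplex (UnitSphere H x)
  UnitSphere-isComplex x =
    (λ z ((Hz , _) , _) → faces-nonempty z Hz) ,
    λ z y ((Hy , (t , Ht , x⊆t , y⊆t)) , x⊈y) z≠∅ z⊆y →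
      (faces-closed z y Hy z≠∅ z⊆y , t , Ht , x⊆t , ⊆-trans z⊆y y⊆t) , x⊈y ∘ flip ⊆-trans z⊆y

  vertex∈ : ∀ {z v} → H z → v ∈ z → H ⁅ v ⁆
  vertex∈ Hz v∈z = faces-closed _ _ Hz (_ , x∈⁅x⁆ _) (⁅x⁆⊆p v∈z)

  x∈p⇒p-x∈Link : ∀ {z v} → H z → v ∈ z → Augmented (Link H v) (z ∖ v)
  x∈p⇒p-x∈Link {z} {v} Hz v∈z with nonempty? (z ∖ v)
  ... | no  z∖v≡∅ = inj₁ z∖v≡∅
  ... | yes z∖v≠∅ =
    inj₂ ((faces-closed _ _ Hz z∖v≠∅ (p─q⊆p z _) , z , Hz , ⁅x⁆⊆p v∈z , p─q⊆p z _) ,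
          λ v⊆z∖v → x∉p-x {p = z} (v⊆z∖v (x∈⁅x⁆ v)))

  Link-⊂⇒⊂ : ∀ {v y′ z} → Link H v y′ → v ∈ z → z ∖ v ⊂ y′ → ∃ λ y → H y × z ⊂ y
  Link-⊂⇒⊂ {v} {y′} {z} ((_ , y , Hy , v⊆y , y′⊆y) , v⊈y′) v∈z (z∖v⊆y′ , u , u∈y′ , u∉z∖v) =
    y , Hy , z⊆y , u , y′⊆y u∈y′ , u∉z
    where
    z⊆y : z ⊆ y
    z⊆y x∈z with ∈-∖-split {y = v} x∈z
    ... | inj₁ refl    = v⊆y (x∈⁅x⁆ v)
    ... | inj₂ x∈z∖v   = y′⊆y (z∖v⊆y′ x∈z∖v)
    u∉z : u ∉ z
    u∉z u∈z with ∈-∖-split {y = v} u∈z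
    ... | inj₁ refl    = v⊈y′ (⁅x⁆⊆p u∈y′)
    ... | inj₂ u∈z∖v   = u∉z∖v u∈z∖v

Link-DSC : ∀ {m} {H : Complex n} {z v} → IsComplex H → DSCₙ (suc m) H → H z → v ∈ z → DSCₙ m (Link H v)
Link-DSC H-complex (_ , spheres) Hz v∈z = spheres _ (vertex∈ H-complex Hz v∈z)

DSC⇒∣z∣≤m : ∀ m {H : Complex n} {z} → IsComplex H → DSCₙ m H → Augmented H z → ∣ z ∣ ≤ m
DSC⇒∣z∣≤m m _ _ (inj₁ z≡∅) = subst (_≤ m) (sym (Empty⇒∣p∣≡0 z≡∅)) z≤n
DSC⇒∣z∣≤m zero _ H≡∅ (inj₂ Hz) = contradiction Hz (H≡∅ _)
DSC⇒∣z∣≤m (suc m) {z = z} H-complex dsc (inj₂ Hz) with v , v∈z ← proj₁ H-complex z Hz = begin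
  ∣ z ∣          ≡⟨ ∣p∣≡1+∣p-x∣ v∈z ⟩
  suc ∣ z ∖ v ∣  ≤⟨ s≤s (DSC⇒∣z∣≤m m (UnitSphere-isComplex H-complex ⁅ v ⁆)
                          (Link-DSC H-complex dsc Hz v∈z) (x∈p⇒p-x∈Link H-complex Hz v∈z)) ⟩
  suc m          ∎
  where open ≤-Reasoning

DSC-⊂-extend : ∀ m {H : Complex n} {z} → IsComplex H → DSCₙ m H → Augmented H z → ∣ z ∣ < m →
             ∃ λ y → H y × z ⊂ y
DSC-⊂-extend (suc m) H-complex ((y , Hy) , _) (inj₁ z≡∅) _ with u , u∈y ← proj₁ H-complex y Hy =
  y , Hy , (λ x∈z → contradiction (_ , x∈z) z≡∅) , u , u∈y , λ u∈z → z≡∅ (u , u∈z)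
DSC-⊂-extend (suc m) {z = z} H-complex dsc (inj₂ Hz) ∣z∣≤m
  with v , v∈z ← proj₁ H-complex z Hz
  with y′ , Ly′ , z∖v⊂y′ ← DSC-⊂-extend m (UnitSphere-isComplex H-complex ⁅ v ⁆)
         (Link-DSC H-complex dsc Hz v∈z) (x∈p⇒p-x∈Link H-complex Hz v∈z)
         (<-≤-trans (x∈p⇒∣p-x∣<∣p∣ v∈z) (≤-pred ∣z∣≤m))
  = Link-⊂⇒⊂ H-complex Ly′ v∈z z∖v⊂y′

DSC-facet : ∀ m {H : Complex n} {z} → IsComplex H → DSCₙ m H → H z →
            ∃ λ F → H F × z ⊆ F × m ≤ ∣ F ∣
DSC-facet m {H} H-complex dsc = climb m (m≤n+m m _)
  where
  fuel-transfer : ∀ {a b} fuel → m ≤ a + suc fuel → a < b → m ≤ b + fuel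
  fuel-transfer {a} {b} fuel bound a<b = begin
    m               ≤⟨ bound ⟩
    a + suc fuel    ≡⟨ +-suc a fuel ⟩
    suc a + fuel    ≤⟨ +-monoˡ-≤ fuel a<b ⟩
    b + fuel        ∎
    where open ≤-Reasoning

  climb : ∀ fuel {z} → m ≤ ∣ z ∣ + fuel → H z → ∃ λ F → H F × z ⊆ F × m ≤ ∣ F ∣
  climb fuel {z} bound Hz with m ≤? ∣ z ∣
  ... | yes m≤∣z∣ = z , Hz , ⊆-refl , m≤∣z∣
  climb zero       {z} bound Hz | no m≰∣z∣ = contradiction (subst (m ≤_) (+-identityʳ ∣ z ∣) bound) m≰∣z∣
  climb (suc fuel) {z} bound Hz | no m≰∣z∣
    with y , Hy , z⊂y ← DSC-⊂-extend m H-complex dsc (inj₂ Hz) (≰⇒> m≰∣z∣)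
    with F , HF , y⊆F , m≤∣F∣ ← climb fuel (fuel-transfer fuel bound (p⊂q⇒∣p∣<∣q∣ z⊂y)) Hy
    = F , HF , ⊆-trans (proj₁ z⊂y) y⊆F , m≤∣F∣

module _ {a ℓ} {A : Set a} {R : A → A → Set ℓ} where

  AllPairs-lookup : ∀ {xs} → AllPairs R xs → ∀ {i j : Fin (length xs)} → i <ᶠ j → R (lookup xs i) (lookup xs j)
  AllPairs-lookup (x~xs ∷ _)   {zero}  {suc j} _         = All.lookup x~xs (∈-lookup j)
  AllPairs-lookup (_ ∷ chain)  {suc i} {suc j} (s≤s i<j) = AllPairs-lookup chain i<j

  AllPairs-∈ : Symmetric R → ∀ {xs x y} → AllPairs R xs → x ∈ₗ xs → y ∈ₗ xs → x ≢ y → R x y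
  AllPairs-∈ R-sym (_ ∷ _)      (here refl) (here refl) x≢y = contradiction refl x≢y
  AllPairs-∈ R-sym (x~xs ∷ _)   (here refl) (there y∈)  _   = All.lookup x~xs y∈
  AllPairs-∈ R-sym (x~xs ∷ _)   (there x∈)  (here refl) _   = R-sym (All.lookup x~xs x∈)
  AllPairs-∈ R-sym (_ ∷ chain)  (there x∈)  (there y∈)  x≢y = AllPairs-∈ R-sym chain x∈ y∈ x≢y

  module _ (R-refl : Reflexive R) (R-trans : Transitive R) {p} {P : A → Set p} (P? : ∀ x → Dec (P x)) where

    greatest : ∀ {xs} → AllPairs (λ x y → R x y ⊎ R y x) xs →
               All (¬_ ∘ P) xs ⊎ ∃ λ a → a ∈ₗ xs × P a × All (λ x → P x → R x a) xs
    greatest [] = inj₁ []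
    greatest {x ∷ _} (x~xs ∷ chain) with P? x | greatest chain
    ... | no ¬px | inj₁ none = inj₁ (¬px ∷ none)
    ... | no ¬px | inj₂ (a , a∈ , pa , max) = inj₂ (a , there a∈ , pa , (λ px → contradiction px ¬px) ∷ max)
    ... | yes px | inj₁ none =
      inj₂ (x , here refl , px , const R-refl ∷ All.map (λ ¬py py → contradiction py ¬py) none)
    ... | yes px | inj₂ (a , a∈ , pa , max) with All.lookup x~xs a∈
    ...   | inj₁ xRa = inj₂ (a , there a∈ , pa , const xRa ∷ max)
    ...   | inj₂ aRx = inj₂ (x , here refl , px , const R-refl ∷ All.map (λ yRa py → R-trans (yRa py) aRx) max)

InRange : ℕ → ℕ → ℕ → Set
InRange lo L s = lo ≤ s × s < lo + L

module _ {a} {A : Set a} (rank : A → ℕ) (lo L : ℕ) where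

  private
    offset : ∀ {s} → InRange lo L s → Fin L
    offset {s} (lo≤s , s<lo+L) = fromℕ< (subst (s ∸ lo <_) (m+n∸m≡n lo L) (∸-monoˡ-< s<lo+L lo≤s))

    offset-injective : ∀ {s t} (s∈ : InRange lo L s) (t∈ : InRange lo L t) → offset s∈ ≡ offset t∈ → s ≡ t
    offset-injective {s} {t} s∈@(lo≤s , _) t∈@(lo≤t , _) same = begin
      s            ≡⟨ m∸n+n≡m lo≤s ⟨
      s ∸ lo + lo  ≡⟨ cong (_+ lo) (trans (sym (toℕ-fromℕ< _)) (trans (cong toℕ same) (toℕ-fromℕ< _))) ⟩
      t ∸ lo + lo  ≡⟨ m∸n+n≡m lo≤t ⟩
      t            ∎
      where open ≡-Reasoning

  distinct-ranks⇒length≤ : ∀ {xs} → AllPairs (λ x y → rank x ≢ rank y) xs → All (InRange lo L ∘ rank) xs → length xs ≤ L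
  distinct-ranks⇒length≤ {xs} distinct in-range with length xs ≤? L
  ... | yes fits = fits
  ... | no overfull
    with i , j , i<j , same ← pigeonhole (≰⇒> overfull) (λ i → offset (All.lookup in-range (∈-lookup i)))
    = contradiction (offset-injective (All.lookup in-range (∈-lookup i)) (All.lookup in-range (∈-lookup j)) same)
                    (AllPairs-lookup distinct i<j)

  missing-rank : ∀ xs → length xs < L → ∃ λ s → InRange lo L s × All (λ x → rank x ≢ s) xs
  missing-rank xs short with anyFin? (λ (i : Fin L) → ¬? (any? (λ x → rank x ≟ℕ lo + toℕ i) xs))
  ... | yes (i , unused) = lo + toℕ i , (m≤m+n lo _ , +-monoʳ-< lo (toℕ<n i)) , ¬Any⇒All¬ xs unused
  ... | no all-used = contradiction (injective⇒≤ position-injective) (<⇒≱ short)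
    where
    used : ∀ i → Any (λ x → rank x ≡ lo + toℕ i) xs
    used i = decidable-stable (any? (λ x → rank x ≟ℕ lo + toℕ i) xs) (λ unused → all-used (i , unused))

    position-injective : Injective _≡_ _≡_ (λ i → Any.index (used i))
    position-injective {i} {j} same = toℕ-injective (+-cancelˡ-≡ lo _ _ (begin
      lo + toℕ i                             ≡⟨ lookup-index (used i) ⟨
      rank (lookup xs (Any.index (used i)))  ≡⟨ cong (rank ∘ lookup xs) same ⟩
      rank (lookup xs (Any.index (used j)))  ≡⟨ lookup-index (used j) ⟩
      lo + toℕ j                             ∎))
      where open ≡-Reasoning

Adj-sym : ∀ {x y : Subset n} → Adj x y → Adj y x
Adj-sym (x≢y , comparable) = x≢y ∘ sym , swap comparable

Adj⇒∣p∣≢∣q∣ : Adj p q → ∣ p ∣ ≢ ∣ q ∣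
Adj⇒∣p∣≢∣q∣ (p≢q , inj₁ p⊆q) = <⇒≢ (p⊂q⇒∣p∣<∣q∣ (⊆∧≢⇒⊂ p⊆q p≢q))
Adj⇒∣p∣≢∣q∣ (p≢q , inj₂ q⊆p) = >⇒≢ (p⊂q⇒∣p∣<∣q∣ (⊆∧≢⇒⊂ q⊆p (p≢q ∘ sym)))

Adj∧∣p∣<∣q∣⇒p⊆q : Adj p q → ∣ p ∣ < ∣ q ∣ → p ⊆ q
Adj∧∣p∣<∣q∣⇒p⊆q (_ , inj₁ p⊆q) _       = p⊆q
Adj∧∣p∣<∣q∣⇒p⊆q (_ , inj₂ q⊆p) ∣p∣<∣q∣ = contradiction (p⊆q⇒∣p∣≤∣q∣ q⊆p) (<⇒≱ ∣p∣<∣q∣)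

Clique : (Subset n → Set) → List (Subset n) → Set
Clique W cs = All W cs × AllPairs Adj cs

record CliquePure (m : ℕ) (W : Subset n → Set) : Set where
  field
    clique-length≤ : ∀ {cs} → Clique W cs → length cs ≤ m
    clique-extend  : ∀ {cs} → Clique W cs → length cs < m → ∃ λ w → W w × All (Adj w) cs

CliquePure-sphere : ∀ {m} {W : Subset n → Set} {v} → CliquePure (suc m) W → W v →
                    CliquePure m (λ w → W w × Adj v w)
CliquePure-sphere {W = W} {v} pure Wv = record
  { clique-length≤ = λ clique → ≤-pred (clique-length≤ (cone clique))
  ; clique-extend  = λ clique short →
      let w , Ww , w~v∷cs = clique-extend (cone clique) (s≤s short)
      in  w , (Ww , Adj-sym (All.head w~v∷cs)) , All.tail w~v∷cs
  }
  where
  open CliquePure pure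
  cone : ∀ {cs} → Clique (λ w → W w × Adj v w) cs → Clique W (v ∷ cs)
  cone (in-sphere , chain) = (Wv ∷ All.map proj₁ in-sphere) , (All.map proj₂ in-sphere ∷ chain)

CliquePure⇒DSG : ∀ m {W : Subset n → Set} → CliquePure m W → DSGₙ m W
CliquePure⇒DSG zero    pure v Wv = contradiction (CliquePure.clique-length≤ pure ((Wv ∷ []) , ([] ∷ []))) λ ()
CliquePure⇒DSG (suc m) pure =
  (let w , Ww , _ = CliquePure.clique-extend pure ([] , []) (s≤s z≤n) in w , Ww) ,
  λ v Wv → CliquePure⇒DSG m (CliquePure-sphere pure Wv)

-- With the index written as k + suc r, the end suc k + suc r of the range of sizes
-- reduces to suc (k + suc r), so the bound needs no arithmetic.
module _ {k r : ℕ} {G : Complex n} (G-complex : IsComplex G) (g : Fin n → Fin (suc k))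
         (G-DS : DSCₙ (k + suc r) G) where

  private
    vacuously : ∀ {P Q : Subset n → Set} {cs} → All (¬_ ∘ P) cs → All (λ c → P c → Q c) cs
    vacuously = All.map (λ ¬Pc Pc → contradiction Pc ¬Pc)

  Gg-rank : ∀ {x} → Gg G g x → InRange (suc k) (suc r) ∣ x ∣
  Gg-rank (Gx , g[x]) = Surjects⇒k<∣p∣ g g[x] , s≤s (DSC⇒∣z∣≤m (k + suc r) G-complex G-DS (inj₂ Gx))

  fill-rank-gap : ∀ {p q s cs} → p ⊆ q → Surjects g p → G q → ∣ p ∣ ≤ s → s ≤ ∣ q ∣ →
         All (λ c → ∣ c ∣ < s → c ⊆ p) cs → All (λ c → s < ∣ c ∣ → q ⊆ c) cs → All (λ c → ∣ c ∣ ≢ s) cs →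
         ∃ λ w → Gg G g w × All (Adj w) cs
  fill-rank-gap {p} {q} {s} {cs} p⊆q g[p] Gq ∣p∣≤s s≤∣q∣ below above avoids
    with w , p⊆w , w⊆q , refl ← subset-between p⊆q ∣p∣≤s s≤∣q∣
    = w , (Gw , g[w]) , All.tabulate adjacent
    where
    g[w] : Surjects g w
    g[w] a = let v , v∈p , gv≡a = g[p] a in v , p⊆w v∈p , gv≡a

    Gw : G w
    Gw = proj₂ G-complex w q Gq (let v , v∈w , _ = g[w] zero in v , v∈w) w⊆q

    adjacent : ∀ {c} → c ∈ₗ cs → Adj w c
    adjacent {c} c∈ with <-cmp ∣ c ∣ ∣ w ∣
    ... | tri< ∣c∣<s _ _ = (λ w≡c → All.lookup avoids c∈ (cong ∣_∣ (sym w≡c))) ,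
                           inj₂ (⊆-trans (All.lookup below c∈ ∣c∣<s) p⊆w)
    ... | tri≈ _ ∣c∣≡s _ = contradiction ∣c∣≡s (All.lookup avoids c∈)
    ... | tri> _ _ s<∣c∣ = (λ w≡c → All.lookup avoids c∈ (cong ∣_∣ (sym w≡c))) ,
                           inj₁ (⊆-trans w⊆q (All.lookup above c∈ s<∣c∣))

  Gg-clique-extend : ∀ {x₀ cs} → Gg G g x₀ → Clique (Gg G g) cs → length cs < suc r →
                     ∃ λ w → Gg G g w × All (Adj w) cs
  Gg-clique-extend {x₀} {cs} (Gx₀ , g[x₀]) (in-W , chain) short
    with s , (k<s , s≤k+r+1) , avoids ← missing-rank ∣_∣ (suc k) (suc r) cs short
    with greatest {R = _⊆_} ⊆-refl ⊆-trans (λ c → ∣ c ∣ <? s) (AllPairs.map proj₂ chain)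
       | greatest {R = flip _⊆_} ⊆-refl (flip ⊆-trans) (λ c → s <? ∣ c ∣) (AllPairs.map (swap ∘ proj₂) chain)
  ... | inj₂ (a , a∈ , ∣a∣<s , below⊆a) | inj₂ (b , b∈ , s<∣b∣ , b⊆above) =
    fill-rank-gap a⊆b (proj₂ (All.lookup in-W a∈)) (proj₁ (All.lookup in-W b∈)) (<⇒≤ ∣a∣<s) (<⇒≤ s<∣b∣)
                  below⊆a b⊆above avoids
    where
    ∣a∣<∣b∣ : ∣ a ∣ < ∣ b ∣
    ∣a∣<∣b∣ = <-trans ∣a∣<s s<∣b∣
    a⊆b : a ⊆ b
    a⊆b = Adj∧∣p∣<∣q∣⇒p⊆q (AllPairs-∈ Adj-sym chain a∈ b∈ (<⇒≢ ∣a∣<∣b∣ ∘ cong ∣_∣)) ∣a∣<∣b∣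
  ... | inj₂ (a , a∈ , ∣a∣<s , below⊆a) | inj₁ none-above =
    let Ga , g[a] = All.lookup in-W a∈
        F , GF , a⊆F , top≤∣F∣ = DSC-facet (k + suc r) G-complex G-DS Ga
    in  fill-rank-gap a⊆F g[a] GF (<⇒≤ ∣a∣<s) (≤-trans (≤-pred s≤k+r+1) top≤∣F∣)
                      below⊆a (vacuously none-above) avoids
  ... | inj₁ none-below | inj₂ (b , b∈ , s<∣b∣ , b⊆above) =
    let Gb , g[b] = All.lookup in-W b∈
        t , t⊆b , g[t] , ∣t∣≤k+1 = transversal g g[b]
    in  fill-rank-gap t⊆b g[t] Gb (≤-trans ∣t∣≤k+1 k<s) (<⇒≤ s<∣b∣)
                      (vacuously none-below) b⊆above avoids
  ... | inj₁ none-below | inj₁ none-above =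
    let t , t⊆x₀ , g[t] , ∣t∣≤k+1 = transversal g g[x₀]
        F , GF , x₀⊆F , top≤∣F∣ = DSC-facet (k + suc r) G-complex G-DS Gx₀
    in  fill-rank-gap (⊆-trans t⊆x₀ x₀⊆F) g[t] GF (≤-trans ∣t∣≤k+1 k<s) (≤-trans (≤-pred s≤k+r+1) top≤∣F∣)
                      (vacuously none-below) (vacuously none-above) avoids

  Gg-CliquePure : ∀ {x₀} → Gg G g x₀ → CliquePure (suc r) (Gg G g)
  Gg-CliquePure {x₀} x₀∈Gg = record
    { clique-length≤ = λ (in-W , chain) →
        distinct-ranks⇒length≤ ∣_∣ (suc k) (suc r) (AllPairs.map Adj⇒∣p∣≢∣q∣ chain) (All.map Gg-rank in-W)
    ; clique-extend  = Gg-clique-extend {x₀} x₀∈Gg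
    }

mainTheorem3 : (n : ℕ) (G : Complex n) → IsComplex G →
    (q : ℤ) → DSComplex q G →
    (k : ℕ) → 1 ≤ k → (g : Fin n → Fin (suc k)) →
    (∃ λ x → Gg G g x) →
    DSSubset (q - + k) (Gg G g)
mainTheorem3 n G G-complex (+ q) G-DS k _ g (x₀ , Gx₀ , g[x₀]) =
  subst (λ d → DSSubset d (Gg G g)) (sym q-k≡r)
        (CliquePure⇒DSG (suc r) (Gg-CliquePure G-complex g G-DS′ (Gx₀ , g[x₀])))
  where
  k≤q : k ≤ q
  k≤q = ≤-pred (≤-trans (Surjects⇒k<∣p∣ g g[x₀]) (DSC⇒∣z∣≤m (suc q) G-complex G-DS (inj₂ Gx₀)))
  r : ℕ
  r = q ∸ k
  G-DS′ : DSCₙ (k + suc r) G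
  G-DS′ = subst (λ d → DSCₙ d G) (trans (cong suc (sym (m+[n∸m]≡n k≤q))) (sym (+-suc k r))) G-DS
  q-k≡r : + q - + k ≡ + r
  q-k≡r = trans (m-n≡m⊖n q k) (⊖-≥ k≤q)
mainTheorem3 n G _ -[1+ zero  ] G-empty k _ g (x₀ , Gx₀ , _) = contradiction Gx₀ (G-empty x₀)
mainTheorem3 n G _ -[1+ suc _ ] ()      k _ g _
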